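{- Let $G=(V,E)$ be a graph and $f:V\to\{0,1\}$ a labelling with strictly more vertices labelled $0$ than $1$. Construct $G'=(V',E')$ from $G$ by attaching, for every $v\in V$ with $f(v)=0$, one new leaf $w$ adjacent only to $v$. Define $k:V'\to\mathbb{Z}_{\ge 0}$ by $k(v)=\lceil d_G(v)/2\rceil$ for $v\in V$ and $k(w)=1$ for every new leaf $w\in V'\setminus V$. Then solutions of the Total Vector Domination problem on $(G',k)$ correspond to solutions of the Eliminating Illusion problem on $(G,f)$, up to the vertices of $G$ originally labelled $0$. Precisely: the minimum size of a labelling $f'$ of $G$ that induces no illusion, measured by $|\{v\in V: f(v)\neq f'(v)\}|$, equals the minimum size of a set $S\subseteq V'$ with $|S\cap N_{G'}(v)|\ge k(v)$ for all $v\in V'$, minus $|\{v\in V: f(v)=0\}|$.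
   Context: For a graph $G=(V,E)$ with labelling $f:V\to\{0,1\}$, a vertex $v$ is under illusion by $f$ if $|\{u\in N(v): f(u)=1\}|>|\{u\in N(v):f(u)=0\}|$. A labelling $f'$ induces no illusion if no vertex is under illusion by $f'$; its size (relative to $f$) is $|\{v: f(v)\ne f'(v)\}|$. Eliminating Illusion: given $(G,f)$ (with strictly more $0$-labelled than $1$-labelled vertices) find a labelling $f'$ inducing no illusion of minimum size. Total Vector Domination: given a graph $H$ and a vector $(k(v))_{v\in V(H)}$ with $k(v)\in\{0,\dots,d_H(v)\}$, find a minimum-size $S\subseteq V(H)$ with $|S\cap N_H(v)|\ge k(v)$ for all $v$. $d_G(v)$ denotes the degree of $v$ in $G$. -}

module Defs where

open import Data.Nat using (ℕ; _≤_; _<_; _+_; ⌈_/2⌉)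
open import Data.Bool using (Bool; true; false; _∧_; not)
open import Data.Fin using (Fin)
open import Data.Fin.Properties using (_≟_)
open import Data.List using (List; []; _∷_; _++_; map; length; filterᵇ; allFin)
open import Data.Sum using (_⊎_; inj₁; inj₂)
open import Data.Product using (Σ; ∃; _×_; _,_; proj₁)
open import Relation.Nullary.Decidable using (⌊_⌋)
open import Relation.Binary.PropositionalEquality using (_≡_)

count : {A : Set} → List A → (A → Bool) → ℕ
count xs p = length (filterᵇ p xs)

-- Finite graphs given by a vertex type, an enumeration of its
-- vertices (each exactly once) and a boolean adjacency relation.
record Graph : Set₁ where
  field
    V     : Set
    verts : List V
    adj   : V → V → Bool

open Graph public

nbCount : (H : Graph) → (V H → Bool) → V H → ℕ
nbCount H S v = count (verts H) (λ u → adj H v u ∧ S u)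

IsTVDSet : (H : Graph) → (V H → ℕ) → (V H → Bool) → Set
IsTVDSet H k S = ∀ v → k v ≤ nbCount H S v

tvdSize : (H : Graph) → (V H → Bool) → ℕ
tvdSize H S = count (verts H) S

IsMinTVD : (H : Graph) → (V H → ℕ) → ℕ → Set
IsMinTVD H k m =
  (Σ (V H → Bool) λ S → IsTVDSet H k S × tvdSize H S ≡ m)
  × (∀ S → IsTVDSet H k S → m ≤ tvdSize H S)

-- The simple graph G on vertex set Fin n, adjacency adj (assumed
-- symmetric and irreflexive in the theorem); labels: true = 1, false = 0.

Labelling : ℕ → Set
Labelling n = Fin n → Bool

ones zeros : {n : ℕ} → (Fin n → Fin n → Bool) → Labelling n → Fin n → ℕ
ones  {n} adj f v = count (allFin n) (λ u → adj v u ∧ f u)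
zeros {n} adj f v = count (allFin n) (λ u → adj v u ∧ not (f u))

UnderIllusion : {n : ℕ} → (Fin n → Fin n → Bool) → Labelling n → Fin n → Set
UnderIllusion adj f v = zeros adj f v < ones adj f v

InducesNoIllusion : {n : ℕ} → (Fin n → Fin n → Bool) → Labelling n → Set
InducesNoIllusion adj f = ∀ v → ¬' (UnderIllusion adj f v)
  where
    open import Data.Empty using (⊥)
    ¬' : Set → Set
    ¬' P = P → ⊥

relSize : {n : ℕ} → Labelling n → Labelling n → ℕ
relSize {n} f f' = count (allFin n) (λ v → not (⌊ Data.Bool._≟_ (f v) (f' v) ⌋))
  where import Data.Bool

numZeros numOnes : {n : ℕ} → Labelling n → ℕ
numZeros {n} f = count (allFin n) (λ v → not (f v))
numOnes  {n} f = count (allFin n) f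

IsMinEI : {n : ℕ} → (Fin n → Fin n → Bool) → Labelling n → ℕ → Set
IsMinEI adj f m =
  (Σ (Labelling _) λ f' → InducesNoIllusion adj f' × relSize f f' ≡ m)
  × (∀ f' → InducesNoIllusion adj f' → m ≤ relSize f f')

Leaf : {n : ℕ} → Labelling n → Set
Leaf {n} f = Σ (Fin n) λ v → f v ≡ false

leafList : {n : ℕ} → (f : Labelling n) → List (Fin n) → List (Leaf f)
leafList f [] = []
leafList f (v ∷ vs) with f v in eq
... | false = (v , eq) ∷ leafList f vs
... | true  = leafList f vs

V' : {n : ℕ} → Labelling n → Set
V' {n} f = Fin n ⊎ Leaf f

adj' : {n : ℕ} → (Fin n → Fin n → Bool) → (f : Labelling n) → V' f → V' f → Bool
adj' adj f (inj₁ a) (inj₁ b)       = adj a b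
adj' adj f (inj₁ a) (inj₂ (b , _)) = ⌊ a ≟ b ⌋
adj' adj f (inj₂ (a , _)) (inj₁ b) = ⌊ a ≟ b ⌋
adj' adj f (inj₂ _) (inj₂ _)       = false

G' : {n : ℕ} → (Fin n → Fin n → Bool) → Labelling n → Graph
G' {n} adj f = record
  { V     = V' f
  ; verts = map inj₁ (allFin n) ++ map inj₂ (leafList f (allFin n))
  ; adj   = adj' adj f }

degG : {n : ℕ} → (Fin n → Fin n → Bool) → Fin n → ℕ
degG {n} adj v = count (allFin n) (adj v)

kVec : {n : ℕ} → (Fin n → Fin n → Bool) → (f : Labelling n) → V' f → ℕ
kVec adj f (inj₁ v) = ⌈ degG adj v /2⌉
kVec adj f (inj₂ _) = 1

module Submission where

-- A labelling induces no illusion exactly when every vertex v has at least ⌈d(v)/2⌉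
-- neighbours labelled 0, i.e. when its 0-set is a total vector dominating set of G for the
-- demand ⌈d/2⌉.  An optimal labelling never turns a 0 into a 1, so its 0-set contains the
-- 0-set Z of f and its cost is its size minus |Z|; the leaves of G′, each of demand 1, force
-- Z into every dominating set of G′.  Conversely a chosen leaf only serves its owner v, and
-- can be traded for a neighbour of v that is not yet chosen; if there is none, v is already
-- dominated by all its neighbours and the leaf can simply be dropped.  So leaves never help,
-- and the two optima differ by exactly |Z|.

open import Data.Bool as Bool using (Bool; true; false; _∧_; _∨_; not; b≤b; f≤t)
open import Data.Bool.Properties using (not-involutive; ∧-zeroʳ)
import Data.Bool.Properties as Boolₚ
open import Data.Empty using (⊥-elim)
open import Data.Fin using (Fin; zero; suc)
open import Data.Fin.Properties using (_≟_; any?; all?)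
open import Data.Fin.Subset.Properties using (anySubset?)
open import Data.List using (List; []; _∷_; _++_; map; length; filterᵇ; allFin)
open import Data.List.Membership.Propositional using (_∈_)
open import Data.List.Membership.Propositional.Properties using (∈-allFin)
open import Data.List.Properties using (length-map; map-tabulate)
open import Data.List.Relation.Unary.Any using (here; there)
open import Data.Nat using (ℕ; zero; suc; _+_; _≤_; _<_; _<?_; z≤n; s≤s; ⌊_/2⌋; ⌈_/2⌉)
open import Data.Nat.Properties
  using (≤-trans; ≤-reflexive; ≤-antisym; +-monoˡ-≤; +-mono-≤; +-cancelʳ-≤; +-suc; +-identityʳ;
         m≤m+n; m≤n⇒m≤1+n; n≤1+n; ≮⇒≥; ≤⇒≯; n≮0; module ≤-Reasoning;
         ⌈n/2⌉-mono; ⌈n/2⌉≤n; ⌊n/2⌋≤⌈n/2⌉; ⌊n/2⌋+⌈n/2⌉≡n; n≡⌈n+n/2⌉)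
  renaming (_≟_ to _≟ℕ_)
open import Data.Product using (Σ; ∃; _×_; _,_; proj₁)
open import Data.Sum using (inj₁; inj₂)
open import Data.Vec using (lookup) renaming (tabulate to tabulateᵛ)
open import Data.Vec.Properties using (lookup∘tabulate)
open import Relation.Binary.Definitions using (_Respects_)
open import Relation.Binary.PropositionalEquality
open import Relation.Nullary using (Dec; yes; no; ¬?; _×-dec_)
open import Relation.Nullary.Decidable using (⌊_⌋; map′; ⌊⌋-map′)
open import Relation.Unary using (Pred; Decidable)

open import Defs

IsMinimum : {A : Set} → (A → Set) → (A → ℕ) → ℕ → Set
IsMinimum {A} P c m = (Σ A λ a → P a × c a ≡ m) × (∀ a → P a → m ≤ c a)

least-witness : ∀ {p} {P : Pred ℕ p} → Decidable P → ∀ {m} → P m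
              → Σ ℕ λ k → P k × (∀ {j} → P j → k ≤ j)
least-witness P? Pm with P? 0
... | yes P0 = 0 , P0 , λ _ → z≤n
least-witness P? {zero}  Pm | no ¬P0 = ⊥-elim (¬P0 Pm)
least-witness P? {suc m} Pm | no ¬P0 with least-witness (λ j → P? (suc j)) Pm
... | k , Pk , least = suc k , Pk , λ { {zero} P0 → ⊥-elim (¬P0 P0) ; {suc j} Pj → s≤s (least Pj) }

minimum-exists : ∀ {A : Set} {P : A → Set} (c : A → ℕ)
               → (∀ m → Dec (∃ λ a → P a × c a ≡ m)) → ∀ {a} → P a → ∃ (IsMinimum P c)
minimum-exists c attains? {a} Pa with least-witness attains? (a , Pa , refl)
... | m , attained , least = m , attained , λ a Pa → least (a , Pa , refl)

minimum-transfer : ∀ {A B : Set} {P : A → Set} {Q : B → Set} {c : A → ℕ} {d : B → ℕ} {m z : ℕ}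
  → IsMinimum P c m
  → (∀ a → P a → Σ B λ b → Q b × d b ≤ c a + z)
  → (∀ b → Q b → Σ A λ a → P a × c a + z ≤ d b)
  → IsMinimum Q d (m + z)
minimum-transfer {Q = Q} {c = c} {d} {z = z} ((a , Pa , refl) , least) P→Q Q→P with P→Q a Pa
... | b , Qb , db≤ = (b , Qb , ≤-antisym db≤ (lower b Qb)) , lower
  where
    lower : ∀ b → Q b → c a + z ≤ d b
    lower b Qb with Q→P b Qb
    ... | a′ , Pa′ , le = ≤-trans (+-monoˡ-≤ z (least a′ Pa′)) le

∃-labelling? : ∀ {n p} {P : Pred (Fin n → Bool) p} → P Respects _≗_ → Decidable P → Dec (∃ P)
∃-labelling? resp P? =
  map′ (λ (s , Ps) → lookup s , Ps)
       (λ (g , Pg) → tabulateᵛ g , resp (λ i → sym (lookup∘tabulate g i)) Pg)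
       (anySubset? (λ s → P? (lookup s)))

_⊆_ : {A : Set} → (A → Bool) → (A → Bool) → Set
p ⊆ q = ∀ x → p x Bool.≤ q x

⊆-refl : {A : Set} {p : A → Bool} → p ⊆ p
⊆-refl _ = Boolₚ.≤-refl

⊆-trans : {A : Set} {p q r : A → Bool} → p ⊆ q → q ⊆ r → p ⊆ r
⊆-trans p⊆q q⊆r x = Boolₚ.≤-trans (p⊆q x) (q⊆r x)

module _ {A : Set} where

  count-cong : ∀ {p q : A → Bool} → p ≗ q → ∀ xs → count xs p ≡ count xs q
  count-cong p≗q [] = refl
  count-cong {p} {q} p≗q (x ∷ xs) with p x | q x | p≗q x
  ... | true  | true  | refl = cong suc (count-cong p≗q xs)
  ... | false | false | refl = count-cong p≗q xs

  count-mono : ∀ {p q : A → Bool} → p ⊆ q → ∀ xs → count xs p ≤ count xs q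
  count-mono p⊆q [] = z≤n
  count-mono {p} {q} p⊆q (x ∷ xs) with p x | q x | p⊆q x
  ... | false | false | b≤b = count-mono p⊆q xs
  ... | false | true  | f≤t = m≤n⇒m≤1+n (count-mono p⊆q xs)
  ... | true  | true  | b≤b = s≤s (count-mono p⊆q xs)

  count-mono-< : ∀ {p q : A → Bool} {x xs} → p ⊆ q → x ∈ xs → p x ≡ false → q x ≡ true
               → suc (count xs p) ≤ count xs q
  count-mono-< {p} {q} {xs = y ∷ ys} p⊆q (here refl) px qx rewrite px | qx = s≤s (count-mono p⊆q ys)
  count-mono-< {p} {q} {xs = y ∷ ys} p⊆q (there x∈ys) px qx with p y | q y | p⊆q y
  ... | false | false | b≤b = count-mono-< p⊆q x∈ys px qx
  ... | false | true  | f≤t = m≤n⇒m≤1+n (count-mono-< p⊆q x∈ys px qx)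
  ... | true  | true  | b≤b = s≤s (count-mono-< p⊆q x∈ys px qx)

  count-∈ : ∀ {p : A → Bool} {x xs} → x ∈ xs → p x ≡ true → 1 ≤ count xs p
  count-∈ {p} {xs = y ∷ ys} (here refl) px rewrite px = s≤s z≤n
  count-∈ {p} {xs = y ∷ ys} (there x∈ys) px with p y
  ... | true  = s≤s z≤n
  ... | false = count-∈ x∈ys px

  count-none : ∀ {p : A → Bool} → (∀ x → p x ≡ false) → ∀ xs → count xs p ≡ 0
  count-none p≡false [] = refl
  count-none {p} p≡false (x ∷ xs) rewrite p≡false x = count-none p≡false xs

  count-++ : ∀ (p : A → Bool) xs ys → count (xs ++ ys) p ≡ count xs p + count ys p
  count-++ p [] ys = refl
  count-++ p (x ∷ xs) ys with p x
  ... | true  = cong suc (count-++ p xs ys)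
  ... | false = count-++ p xs ys

  count-map : ∀ {B : Set} (g : B → A) (p : A → Bool) xs → count (map g xs) p ≡ count xs (λ x → p (g x))
  count-map g p [] = refl
  count-map g p (x ∷ xs) with p (g x)
  ... | true  = cong suc (count-map g p xs)
  ... | false = count-map g p xs

  count-filterᵇ : ∀ (p q : A → Bool) xs → count (filterᵇ q xs) p ≡ count xs (λ x → p x ∧ q x)
  count-filterᵇ p q [] = refl
  count-filterᵇ p q (x ∷ xs) with q x
  ... | false rewrite ∧-zeroʳ (p x) = count-filterᵇ p q xs
  ... | true with p x
  ...   | true  = cong suc (count-filterᵇ p q xs)
  ...   | false = count-filterᵇ p q xs

  count-inclusion-exclusion : ∀ (p q : A → Bool) xs
    → count xs (λ x → p x ∨ q x) + count xs (λ x → p x ∧ q x) ≡ count xs p + count xs q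
  count-inclusion-exclusion p q [] = refl
  count-inclusion-exclusion p q (x ∷ xs) with p x | q x
  ... | true  | true  =
    cong suc (trans (+-suc _ _) (trans (cong suc (count-inclusion-exclusion p q xs)) (sym (+-suc _ _))))
  ... | true  | false = cong suc (count-inclusion-exclusion p q xs)
  ... | false | true  = trans (cong suc (count-inclusion-exclusion p q xs)) (sym (+-suc _ _))
  ... | false | false = count-inclusion-exclusion p q xs

  count-∨-≤ : ∀ (p q : A → Bool) xs → count xs (λ x → p x ∨ q x) ≤ count xs p + count xs q
  count-∨-≤ p q xs = ≤-trans (m≤m+n _ _) (≤-reflexive (count-inclusion-exclusion p q xs))

  count-disjoint-∨ : ∀ (p q : A → Bool) → (∀ x → p x ∧ q x ≡ false) → ∀ xs
                   → count xs (λ x → p x ∨ q x) ≡ count xs p + count xs q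
  count-disjoint-∨ p q disjoint xs = begin
    count xs p∨q                          ≡⟨ +-identityʳ _ ⟨
    count xs p∨q + 0                      ≡⟨ cong (count xs p∨q +_) (count-none disjoint xs) ⟨
    count xs p∨q + count xs (λ x → p x ∧ q x) ≡⟨ count-inclusion-exclusion p q xs ⟩
    count xs p + count xs q               ∎
    where
      open ≡-Reasoning
      p∨q : A → Bool
      p∨q x = p x ∨ q x

count-allFin-≟ : ∀ {n} (u : Fin n) → count (allFin n) (λ x → ⌊ u ≟ x ⌋) ≡ 1
count-allFin-≟ {suc n} u = begin
  count (allFin (suc n)) (λ x → ⌊ u ≟ x ⌋)
    ≡⟨ cong (λ xs → count (zero ∷ xs) (λ x → ⌊ u ≟ x ⌋)) (sym (map-tabulate (λ x → x) suc)) ⟩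
  count (zero ∷ map suc (allFin n)) (λ x → ⌊ u ≟ x ⌋)
    ≡⟨ at u ⟩
  1 ∎
  where
    open ≡-Reasoning
    at : ∀ u → count (zero ∷ map suc (allFin n)) (λ x → ⌊ u ≟ x ⌋) ≡ 1
    at zero    = cong suc (trans (count-map suc _ (allFin n)) (count-none (λ _ → refl) (allFin n)))
    at (suc u) = trans (count-map suc _ (allFin n))
                       (trans (count-cong (λ x → ⌊⌋-map′ _ _ (u ≟ x)) (allFin n)) (count-allFin-≟ u))

∧-monoʳ-≤ : ∀ a {b c} → b Bool.≤ c → a ∧ b Bool.≤ a ∧ c
∧-monoʳ-≤ true  b≤c = b≤c
∧-monoʳ-≤ false _   = b≤b

nbCount-mono : ∀ (H : Graph) {D D′ : V H → Bool} → D ⊆ D′ → ∀ v → nbCount H D v ≤ nbCount H D′ v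
nbCount-mono H D⊆D′ v = count-mono (λ u → ∧-monoʳ-≤ (adj H v u) (D⊆D′ u)) (verts H)

m≤n⇒⌈m+n/2⌉≤n : ∀ {m n} → m ≤ n → ⌈ m + n /2⌉ ≤ n
m≤n⇒⌈m+n/2⌉≤n {m} {n} m≤n =
  ≤-trans (⌈n/2⌉-mono (+-monoˡ-≤ n m≤n)) (≤-reflexive (sym (n≡⌈n+n/2⌉ n)))

⌈m+n/2⌉≤n⇒m≤n : ∀ {m n} → ⌈ m + n /2⌉ ≤ n → m ≤ n
⌈m+n/2⌉≤n⇒m≤n {m} {n} half≤n = +-cancelʳ-≤ n m n (begin
  m + n                               ≡⟨ ⌊n/2⌋+⌈n/2⌉≡n (m + n) ⟨
  ⌊ m + n /2⌋ + ⌈ m + n /2⌉          ≤⟨ +-monoˡ-≤ _ (⌊n/2⌋≤⌈n/2⌉ (m + n)) ⟩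
  ⌈ m + n /2⌉ + ⌈ m + n /2⌉          ≤⟨ +-mono-≤ half≤n half≤n ⟩
  n + n                               ∎)
  where open ≤-Reasoning

-- Illusions in G

finGraph : ∀ {n} → (Fin n → Fin n → Bool) → Graph
finGraph {n} adj = record { V = Fin n ; verts = allFin n ; adj = adj }

halfDegree : ∀ {n} → (Fin n → Fin n → Bool) → Fin n → ℕ
halfDegree adj v = ⌈ degG adj v /2⌉

module _ {n} (adj : Fin n → Fin n → Bool) where

  degG≡ones+zeros : ∀ g v → degG adj v ≡ ones adj g v + zeros adj g v
  degG≡ones+zeros g v =
    trans (count-cong (λ u → sym (covers (adj v u) (g u))) (allFin n))
          (count-disjoint-∨ _ _ (λ u → disjoint (adj v u) (g u)) (allFin n))
    where
      covers : ∀ a b → (a ∧ b) ∨ (a ∧ not b) ≡ a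
      covers true  true  = refl
      covers true  false = refl
      covers false _     = refl
      disjoint : ∀ a b → (a ∧ b) ∧ (a ∧ not b) ≡ false
      disjoint true  true  = refl
      disjoint true  false = refl
      disjoint false _     = refl

  noIllusion⇒dominating : ∀ {g} → InducesNoIllusion adj g
                        → IsTVDSet (finGraph adj) (halfDegree adj) (λ v → not (g v))
  noIllusion⇒dominating {g} noIllusion v =
    subst (λ d → ⌈ d /2⌉ ≤ zeros adj g v) (sym (degG≡ones+zeros g v))
          (m≤n⇒⌈m+n/2⌉≤n (≮⇒≥ (noIllusion v)))

  dominating⇒noIllusion : ∀ {D} → IsTVDSet (finGraph adj) (halfDegree adj) D
                        → InducesNoIllusion adj (λ v → not (D v))
  dominating⇒noIllusion {D} dominating v = ≤⇒≯ (⌈m+n/2⌉≤n⇒m≤n (begin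
    ⌈ ones adj g v + zeros adj g v /2⌉   ≡⟨ cong ⌈_/2⌉ (degG≡ones+zeros g v) ⟨
    halfDegree adj v                     ≤⟨ dominating v ⟩
    nbCount (finGraph adj) D v
      ≡⟨ count-cong (λ u → cong (adj v u ∧_) (not-involutive (D u))) (allFin n) ⟨
    zeros adj g v                        ∎))
    where
      open ≤-Reasoning
      g : Labelling n
      g v = not (D v)

  noIllusion-respects-≗ : InducesNoIllusion adj Respects _≗_
  noIllusion-respects-≗ {g} {h} g≗h noIllusion v illusion =
    noIllusion v (subst₂ _<_ (count-cong (λ u → cong (λ b → adj v u ∧ not b) (sym (g≗h u))) (allFin n))
                             (count-cong (λ u → cong (adj v u ∧_) (sym (g≗h u))) (allFin n))
                             illusion)

  noIllusion? : Decidable (InducesNoIllusion adj)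
  noIllusion? g = all? (λ v → ¬? (zeros adj g v <? ones adj g v))

  noIllusion-all-zero : InducesNoIllusion adj (λ _ → false)
  noIllusion-all-zero v illusion =
    n≮0 (subst (zeros adj (λ _ → false) v <_) (count-none (λ u → ∧-zeroʳ (adj v u)) (allFin n)) illusion)

module _ {n} (f : Labelling n) where

  relSize-respects-≗ : ∀ {g h} → g ≗ h → relSize f g ≡ relSize f h
  relSize-respects-≗ g≗h = count-cong (λ v → cong (λ b → not ⌊ f v Bool.≟ b ⌋) (g≗h v)) (allFin n)

  relSize-complement : ∀ {D} → (λ v → not (f v)) ⊆ D
                     → relSize f (λ v → not (D v)) + numZeros f ≡ count (allFin n) D
  relSize-complement {D} zeros⊆D =
    sym (trans (count-cong (λ v → sym (covers (f v) (D v) (zeros⊆D v))) (allFin n))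
               (count-disjoint-∨ _ _ (λ v → disjoint (f v) (D v) (zeros⊆D v)) (allFin n)))
    where
      covers : ∀ a d → not a Bool.≤ d → not ⌊ a Bool.≟ not d ⌋ ∨ not a ≡ d
      covers true  true  _   = refl
      covers true  false _   = refl
      covers false true  _   = refl
      covers false false ()
      disjoint : ∀ a d → not a Bool.≤ d → not ⌊ a Bool.≟ not d ⌋ ∧ not a ≡ false
      disjoint true  true  _ = refl
      disjoint true  false _ = refl
      disjoint false true  _ = refl
      disjoint false false ()

minEI-exists : ∀ {n} (adj : Fin n → Fin n → Bool) (f : Labelling n) → ∃ (IsMinEI adj f)
minEI-exists adj f = minimum-exists (relSize f) attains? (noIllusion-all-zero adj)
  where
    attains? : ∀ m → Dec (∃ λ g → InducesNoIllusion adj g × relSize f g ≡ m)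
    attains? m = ∃-labelling? (λ g≗h (noIllusion , size) → noIllusion-respects-≗ adj g≗h noIllusion ,
                                                           trans (sym (relSize-respects-≗ f g≗h)) size)
                              (λ g → noIllusion? adj g ×-dec relSize f g ≟ℕ m)

-- Absorbing leaf credits

module _ {n} (adj : Fin n → Fin n → Bool) where

  absorb-credit : ∀ {k c} v D → k ≤ degG adj v → k ≤ suc (nbCount (finGraph adj) D v + c)
    → Σ (Fin n → Bool) λ D′ → D ⊆ D′ × k ≤ nbCount (finGraph adj) D′ v + c
                            × count (allFin n) D′ ≤ suc (count (allFin n) D)
  absorb-credit {k} {c} v D k≤deg demand with any? (λ u → adj v u ∧ not (D u) Bool.≟ true)
  ... | yes (u , outside) = D′ , D⊆D′ , ≤-trans demand (+-monoˡ-≤ c gains) , size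
    where
      D′ : Fin n → Bool
      D′ x = ⌊ u ≟ x ⌋ ∨ D x
      D⊆D′ : D ⊆ D′
      D⊆D′ x with ⌊ u ≟ x ⌋ | D x
      ... | true  | false = f≤t
      ... | true  | true  = b≤b
      ... | false | _     = b≤b
      split : ∀ a d → a ∧ not d ≡ true → a ≡ true × d ≡ false
      split true false refl = refl , refl
      gains : suc (nbCount (finGraph adj) D v) ≤ nbCount (finGraph adj) D′ v
      gains with split (adj v u) (D u) outside
      ... | edge , u∉D = count-mono-< (λ x → ∧-monoʳ-≤ (adj v x) (D⊆D′ x)) (∈-allFin u)
                           (cong₂ _∧_ edge u∉D)
                           (cong₂ (λ a b → a ∧ (b ∨ D u)) edge (cong ⌊_⌋ (≡-≟-identity _≟_ refl)))
      size : count (allFin n) D′ ≤ suc (count (allFin n) D)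
      size = ≤-trans (count-∨-≤ _ D (allFin n))
                     (≤-reflexive (cong (_+ count (allFin n) D) (count-allFin-≟ u)))
  ... | no allInside = D , ⊆-refl , ≤-trans k≤deg (≤-trans full (m≤m+n _ c)) , n≤1+n _
    where
      full : degG adj v ≤ nbCount (finGraph adj) D v
      full = count-mono covered (allFin n)
        where
          covered : adj v ⊆ (λ u → adj v u ∧ D u)
          covered u with adj v u in a | D u in d
          ... | false | _     = b≤b
          ... | true  | true  = b≤b
          ... | true  | false = ⊥-elim (allInside (u , cong₂ (λ x y → x ∧ not y) a d))

occurrences : ∀ {n} → List (Fin n) → Fin n → ℕ
occurrences ws v = count ws (λ w → ⌊ v ≟ w ⌋)

occurrences-here : ∀ {n} (w : Fin n) ws → occurrences (w ∷ ws) w ≡ suc (occurrences ws w)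
occurrences-here w ws with w ≟ w
... | yes _   = refl
... | no  w≢w = ⊥-elim (w≢w refl)

occurrences-there : ∀ {n} {w v : Fin n} ws → w ≢ v → occurrences (w ∷ ws) v ≡ occurrences ws v
occurrences-there {w = w} {v} ws w≢v with v ≟ w
... | yes v≡w = ⊥-elim (w≢v (sym v≡w))
... | no  _   = refl

module _ {n} (adj : Fin n → Fin n → Bool) (k : Fin n → ℕ) where

  -- Each occurrence of v in ws stands for a chosen leaf of G′ hanging at v.
  IsTVDSetWithCredits : List (Fin n) → (Fin n → Bool) → Set
  IsTVDSetWithCredits ws D = ∀ v → k v ≤ nbCount (finGraph adj) D v + occurrences ws v

  module _ (k≤deg : ∀ v → k v ≤ degG adj v) where

    absorb-first-credit : ∀ w ws D → IsTVDSetWithCredits (w ∷ ws) D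
      → Σ (Fin n → Bool) λ D₁ → D ⊆ D₁ × IsTVDSetWithCredits ws D₁
                              × count (allFin n) D₁ ≤ suc (count (allFin n) D)
    absorb-first-credit w ws D dom
      with absorb-credit adj w D (k≤deg w)
             (subst (k w ≤_) (trans (cong (_ +_) (occurrences-here w ws)) (+-suc _ _)) (dom w))
    ... | D₁ , D⊆D₁ , at-w , size₁ = D₁ , D⊆D₁ , dom₁ , size₁
      where
        dom₁ : IsTVDSetWithCredits ws D₁
        dom₁ v with w ≟ v
        ... | yes refl = at-w
        ... | no  w≢v  = ≤-trans (dom v) (+-mono-≤ (nbCount-mono (finGraph adj) D⊆D₁ v)
                                                    (≤-reflexive (occurrences-there ws w≢v)))

    absorb-credits : ∀ ws D → IsTVDSetWithCredits ws D
      → Σ (Fin n → Bool) λ D′ → D ⊆ D′ × IsTVDSet (finGraph adj) k D′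
                              × count (allFin n) D′ ≤ count (allFin n) D + length ws
    absorb-credits [] D dom = D , ⊆-refl , (λ v → subst (k v ≤_) (+-identityʳ _) (dom v)) , m≤m+n _ 0
    absorb-credits (w ∷ ws) D dom with absorb-first-credit w ws D dom
    ... | D₁ , D⊆D₁ , dom₁ , size₁ with absorb-credits ws D₁ dom₁
    ... | D′ , D₁⊆D′ , dom′ , size′ =
      D′ , ⊆-trans D⊆D₁ D₁⊆D′ , dom′ ,
      ≤-trans size′ (≤-trans (+-monoˡ-≤ (length ws) size₁) (≤-reflexive (sym (+-suc _ _))))

-- The graph G′

module _ {n} (adj : Fin n → Fin n → Bool) (f : Labelling n) where

  leaves : List (Leaf f)
  leaves = leafList f (allFin n)

  ownedLeaves : (V' f → Bool) → List (Leaf f)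
  ownedLeaves S = filterᵇ (λ w → S (inj₂ w)) leaves

  leafOwners : (V' f → Bool) → List (Fin n)
  leafOwners S = map proj₁ (ownedLeaves S)

  embed : (Fin n → Bool) → V' f → Bool
  embed D (inj₁ v) = D v
  embed D (inj₂ _) = false

  nbCount-G′-inj₁ : ∀ S v → nbCount (G' adj f) S (inj₁ v)
                          ≡ nbCount (finGraph adj) (λ u → S (inj₁ u)) v + occurrences (leafOwners S) v
  nbCount-G′-inj₁ S v =
    trans (count-++ _ (map inj₁ (allFin n)) (map inj₂ leaves))
          (cong₂ _+_ (count-map inj₁ _ (allFin n))
                     (trans (count-map inj₂ _ leaves)
                            (sym (trans (count-map proj₁ (λ u → ⌊ v ≟ u ⌋) (ownedLeaves S))
                                        (count-filterᵇ (λ w → ⌊ v ≟ proj₁ w ⌋) (λ w → S (inj₂ w)) leaves)))))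

  nbCount-G′-inj₂ : ∀ S a e → nbCount (G' adj f) S (inj₂ (a , e))
                            ≡ count (allFin n) (λ b → ⌊ a ≟ b ⌋ ∧ S (inj₁ b))
  nbCount-G′-inj₂ S a e =
    trans (count-++ _ (map inj₁ (allFin n)) (map inj₂ leaves))
          (trans (cong₂ _+_ (count-map inj₁ _ (allFin n))
                            (trans (count-map inj₂ _ leaves) (count-none (λ _ → refl) leaves)))
                 (+-identityʳ _))

  tvdSize-G′ : ∀ S → tvdSize (G' adj f) S ≡ count (allFin n) (λ u → S (inj₁ u)) + length (leafOwners S)
  tvdSize-G′ S =
    trans (count-++ S (map inj₁ (allFin n)) (map inj₂ leaves))
          (cong₂ _+_ (count-map inj₁ S (allFin n))
                     (trans (count-map inj₂ S leaves) (sym (length-map proj₁ (ownedLeaves S)))))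

  tvdSize-embed : ∀ D → tvdSize (G' adj f) (embed D) ≡ count (allFin n) D
  tvdSize-embed D = begin
    tvdSize (G' adj f) (embed D)                         ≡⟨ tvdSize-G′ (embed D) ⟩
    count (allFin n) D + length (leafOwners (embed D))   ≡⟨ cong (count (allFin n) D +_) no-owners ⟩
    count (allFin n) D + 0                               ≡⟨ +-identityʳ _ ⟩
    count (allFin n) D                                   ∎
    where
      open ≡-Reasoning
      no-owners : length (leafOwners (embed D)) ≡ 0
      no-owners = trans (length-map proj₁ (ownedLeaves (embed D))) (count-none (λ _ → refl) leaves)

  zeros⊆dominating : ∀ {S} → IsTVDSet (G' adj f) (kVec adj f) S → (λ v → not (f v)) ⊆ (λ v → S (inj₁ v))
  zeros⊆dominating {S} dom v with f v in fv
  ... | true = Boolₚ.≤-minimum _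
  ... | false with S (inj₁ v) in sv
  ...   | true  = b≤b
  ...   | false = ⊥-elim (n≮0 (≤-trans (dom (inj₂ (v , fv)))
                                       (≤-reflexive (trans (nbCount-G′-inj₂ S v fv)
                                                           (count-none unowned (allFin n))))))
    where
      unowned : ∀ b → ⌊ v ≟ b ⌋ ∧ S (inj₁ b) ≡ false
      unowned b with v ≟ b
      ... | yes refl = sv
      ... | no  _    = refl

  embed-dominating : ∀ {D} → (λ v → not (f v)) ⊆ D → IsTVDSet (finGraph adj) (halfDegree adj) D
                   → IsTVDSet (G' adj f) (kVec adj f) (embed D)
  embed-dominating {D} zeros⊆D dom (inj₁ v) =
    ≤-trans (dom v) (≤-trans (m≤m+n _ _) (≤-reflexive (sym (nbCount-G′-inj₁ (embed D) v))))
  embed-dominating {D} zeros⊆D dom (inj₂ (a , e)) =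
    ≤-trans (count-∈ (∈-allFin a) (cong₂ _∧_ (cong ⌊_⌋ (≡-≟-identity _≟_ refl)) a∈D))
            (≤-reflexive (sym (nbCount-G′-inj₂ (embed D) a e)))
    where
      a∈D : D a ≡ true
      a∈D = Boolₚ.≤-antisym (Boolₚ.≤-maximum (D a)) (subst (λ b → not b Bool.≤ D a) e (zeros⊆D a))

  dominating-from-labelling : ∀ g → InducesNoIllusion adj g
    → Σ (V' f → Bool) λ S → IsTVDSet (G' adj f) (kVec adj f) S
                          × tvdSize (G' adj f) S ≤ relSize f g + numZeros f
  dominating-from-labelling g noIllusion =
    embed D , embed-dominating zeros⊆D dom , (begin
      tvdSize (G' adj f) (embed D)                 ≡⟨ tvdSize-embed D ⟩
      count (allFin n) D                           ≡⟨ relSize-complement f zeros⊆D ⟨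
      relSize f (λ v → not (D v)) + numZeros f     ≤⟨ +-monoˡ-≤ _ (count-mono fewer-changes (allFin n)) ⟩
      relSize f g + numZeros f                     ∎)
    where
      open ≤-Reasoning
      D : Fin n → Bool
      D v = not (f v ∧ g v)
      zeros⊆D : (λ v → not (f v)) ⊆ D
      zeros⊆D v with f v
      ... | true  = Boolₚ.≤-minimum _
      ... | false = b≤b
      dom : IsTVDSet (finGraph adj) (halfDegree adj) D
      dom v = ≤-trans (noIllusion⇒dominating adj noIllusion v) (nbCount-mono (finGraph adj) g-zeros⊆D v)
        where
          g-zeros⊆D : (λ v → not (g v)) ⊆ D
          g-zeros⊆D v with f v | g v
          ... | true  | _     = Boolₚ.≤-refl
          ... | false | true  = f≤t
          ... | false | false = b≤b
      fewer-changes : (λ v → not ⌊ f v Bool.≟ not (D v) ⌋) ⊆ (λ v → not ⌊ f v Bool.≟ g v ⌋)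
      fewer-changes v with f v | g v
      ... | true  | true  = b≤b
      ... | true  | false = b≤b
      ... | false | _     = Boolₚ.≤-minimum _

  dominating⇒credited : ∀ {S} → IsTVDSet (G' adj f) (kVec adj f) S
    → IsTVDSetWithCredits adj (halfDegree adj) (leafOwners S) (λ v → S (inj₁ v))
  dominating⇒credited {S} dom v = ≤-trans (dom (inj₁ v)) (≤-reflexive (nbCount-G′-inj₁ S v))

  labelling-from-dominating : ∀ S → IsTVDSet (G' adj f) (kVec adj f) S
    → Σ (Labelling n) λ g → InducesNoIllusion adj g × relSize f g + numZeros f ≤ tvdSize (G' adj f) S
  labelling-from-dominating S dom
    with absorb-credits adj (halfDegree adj) (λ v → ⌈n/2⌉≤n _) (leafOwners S) (λ v → S (inj₁ v))
                        (dominating⇒credited dom)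
  ... | D′ , D⊆D′ , dom′ , size′ = (λ v → not (D′ v)) , dominating⇒noIllusion adj dom′ , (begin
      relSize f (λ v → not (D′ v)) + numZeros f
        ≡⟨ relSize-complement f (⊆-trans (zeros⊆dominating dom) D⊆D′) ⟩
      count (allFin n) D′
        ≤⟨ size′ ⟩
      count (allFin n) (λ v → S (inj₁ v)) + length (leafOwners S)
        ≡⟨ tvdSize-G′ S ⟨
      tvdSize (G' adj f) S
        ∎)
    where open ≤-Reasoning

lemma1 : (n : ℕ) (adj : Fin n → Fin n → Bool)
    → (∀ u v → adj u v ≡ adj v u)
    → (∀ v → adj v v ≡ false)
    → (f : Fin n → Bool)
    → numOnes f < numZeros f
    → Σ ℕ λ m → IsMinEI adj f m × IsMinTVD (G' adj f) (kVec adj f) (m + numZeros f)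
lemma1 n adj _ _ f _ with minEI-exists adj f
... | m , minimal =
  m , minimal , minimum-transfer minimal (dominating-from-labelling adj f) (labelling-from-dominating adj f)
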